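{- Let $A,B,C$ be non-zero integers and let $(x_0,y_0,z_0)$ be a non-trivial integer solution of $Ax^2+By^2+Cz^2=0$ with $z_0\neq0$. Define $$P_x(m,n)=x_0Am^2+2y_0Bmn-x_0Bn^2,\quad P_y(m,n)=-y_0Am^2+2x_0Amn+y_0Bn^2,\quad P_z(m,n)=z_0Am^2+z_0Bn^2.$$ Then the general integer solution of $Ax^2+By^2+Cz^2=0$ is given by $$(x,y,z)=\frac{p}{q}\bigl(P_x(m,n),\,P_y(m,n),\,P_z(m,n)\bigr),$$ where $m,n$ are coprime integers, $p,q$ are coprime integers, and $q>0$ divides $2\,\mathrm{lcm}(A,B)\,C\,z_0^2$. That is, every integer solution $(x,y,z)$ can be written in this form for such $m,n,p,q$ (and every integer triple of this form is a solution). -}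

module Defs where

open import Data.Integer using (ℤ; _+_; _*_; -_; +_; _<_)
open import Data.Integer.Coprimality using (Coprime)
open import Data.Integer.Divisibility using (_∣_)
open import Data.Integer.LCM using (lcm)
open import Data.Product using (_×_)
open import Relation.Binary.PropositionalEquality using (_≡_)

IsSol : ℤ → ℤ → ℤ → ℤ → ℤ → ℤ → Set
IsSol A B C x y z = A * (x * x) + B * (y * y) + C * (z * z) ≡ + 0

Px : (A B x₀ y₀ z₀ m n : ℤ) → ℤ
Px A B x₀ y₀ z₀ m n = x₀ * A * (m * m) + + 2 * y₀ * B * (m * n) + - (x₀ * B * (n * n))

Py : (A B x₀ y₀ z₀ m n : ℤ) → ℤ
Py A B x₀ y₀ z₀ m n = - (y₀ * A * (m * m)) + + 2 * x₀ * A * (m * n) + y₀ * B * (n * n)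

Pz : (A B x₀ y₀ z₀ m n : ℤ) → ℤ
Pz A B x₀ y₀ z₀ m n = z₀ * A * (m * m) + z₀ * B * (n * n)

-- The equality (x,y,z) = (p/q)(Px,Py,Pz)(m,n) is
-- stated without division as q·x = p·Px(m,n), q·y = p·Py(m,n), q·z = p·Pz(m,n).
Represents : (A B C x₀ y₀ z₀ x y z m n p q : ℤ) → Set
Represents A B C x₀ y₀ z₀ x y z m n p q =
  Coprime m n × Coprime p q × + 0 < q ×
  q ∣ + 2 * lcm A B * C * (z₀ * z₀) ×
  q * x ≡ p * Px A B x₀ y₀ z₀ m n ×
  q * y ≡ p * Py A B x₀ y₀ z₀ m n ×
  q * z ≡ p * Pz A B x₀ y₀ z₀ m n

-- The line through the base point (x₀,y₀,z₀) and a solution (x,y,z) meets the conic at the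
-- parameter (m : n) = (M : A K), where M = A x x₀ − B y y₀ − C z z₀ and K = x y₀ + y x₀:
-- modulo both equations, P(M, A K) = −2 A C z₀² M · (x,y,z).  P is symmetric under
-- (A, x₀, m) ↔ (B, y₀, n) with P_x ↔ P_y, which yields a second parameter when M = 0; if that
-- one vanishes too, (x,y,z) = 0.  Dividing (m, n) by its gcd g and writing g² / (−2 A C z₀² M)
-- as p / q in lowest terms gives the representation.  Then q divides P_x, P_y, P_z, and
-- C z₀ P_z ∓ (A x₀ P_x − B y₀ P_y) equal 2 A C z₀² m² and 2 B C z₀² n² modulo the base equation,
-- so q divides 2 lcm(A,B) C z₀² times both m² and n², hence 2 lcm(A,B) C z₀² itself.
-- Conversely Q(P(m,n)) = (A m² + B n²)² Q(x₀,y₀,z₀).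

{-# OPTIONS --safe #-}
module Submission where

open import Defs
open import Data.Integer using (ℤ; +_; +[1+_]; -[1+_]; _+_; _-_; _*_; -_; _<_; +<+; ∣_∣; _≟_; ≢-nonZero)
open import Data.Integer.Properties
  using (+-comm; +-identityʳ; *-assoc; *-identityˡ; *-zeroʳ; *-cancelˡ-≡; neg-injective;
         abs-*; ∣-i∣≡∣i∣; <⇒≢; i*j≡0⇒i≡0∨j≡0; *-commutativeSemigroup)
open import Data.Integer.Divisibility.Signed
  using (_∣_; module _∣_; ∣ᵤ⇒∣; ∣⇒∣ᵤ; ∣-refl; ∣-trans; ∣m⇒∣m*n; ∣n⇒∣m*n; ∣m∣n⇒∣m+n; ∣m∣n⇒∣m-n;
         *-monoˡ-∣; *-monoʳ-∣; *-cancelʳ-∣)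
open import Data.Integer.Coprimality using (Coprime; coprime-divisor) renaming (sym to coprime-sym)
open import Data.Integer.GCD using (gcd; gcd[i,j]∣i; gcd[i,j]∣j; gcd-greatest; gcd[i,j]≡0⇒i≡0; gcd[i,j]≡0⇒j≡0)
open import Data.Integer.LCM using (lcm; i∣lcm[i,j]; j∣lcm[i,j])
import Data.Integer.Divisibility as Unsigned
open import Data.Integer.Tactic.RingSolver using (solve-∀)
import Data.Nat as ℕ
import Data.Nat.Divisibility as ℕ
import Data.Nat.Coprimality as ℕ
open import Algebra.Properties.CommutativeSemigroup *-commutativeSemigroup
  using (x∙yz≈y∙xz; x∙yz≈yx∙z; xy∙z≈y∙xz)
open import Data.Product using (_×_; _,_; proj₁; proj₂; ∃-syntax)
open import Data.Sum using ([_,_]′)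
open import Function using (id; _∘_)
open import Relation.Nullary using (¬_; yes; no; contradiction)
open import Relation.Binary.PropositionalEquality
  using (_≡_; _≢_; refl; sym; trans; cong; cong₂; subst; module ≡-Reasoning)

*-≢0 : ∀ {i j} → i ≢ + 0 → j ≢ + 0 → i * j ≢ + 0
*-≢0 i≢0 j≢0 ij≡0 = [ i≢0 , j≢0 ]′ (i*j≡0⇒i≡0∨j≡0 _ ij≡0)

i*j≡0⇒j≡0 : ∀ {i j} → i ≢ + 0 → i * j ≡ + 0 → j ≡ + 0
i*j≡0⇒j≡0 i≢0 ij≡0 = [ (λ i≡0 → contradiction i≡0 i≢0) , id ]′ (i*j≡0⇒i≡0∨j≡0 _ ij≡0)

-2≢0 : - + 2 ≢ + 0
-2≢0 ()

i*i≡0⇒i≡0 : ∀ {i} → i * i ≡ + 0 → i ≡ + 0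
i*i≡0⇒i≡0 ii≡0 = [ id , id ]′ (i*j≡0⇒i≡0∨j≡0 _ ii≡0)

-i*-j≡i*j : ∀ i j → (- i) * (- j) ≡ i * j
-i*-j≡i*j = solve-∀

drop-null-term : ∀ {u v e c} → e ≡ + 0 → u ≡ v + e * c → u ≡ v
drop-null-term {v = v} refl u≡v+0 = trans u≡v+0 (+-identityʳ v)

coprime-factors : ∀ {m n d o} → Coprime m n → d ∣ m * o → d ∣ n * o → d ∣ o
coprime-factors {m} {n} {d} {o} m⊥n d∣mo d∣no = ∣ᵤ⇒∣ (ℕ.coprime-factors m⊥n (abs-∣ m d∣mo , abs-∣ n d∣no))
  where
  abs-∣ : ∀ k → d ∣ k * o → ∣ d ∣ ℕ.∣ ∣ k ∣ ℕ.* ∣ o ∣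
  abs-∣ k d∣ko = subst (∣ d ∣ ℕ.∣_) (abs-* k o) (∣⇒∣ᵤ d∣ko)

coprime-factors-square : ∀ {m n d o} → Coprime m n → d ∣ m * o → d ∣ (n * n) * o → d ∣ o
coprime-factors-square {m} {n} {d} {o} m⊥n d∣mo d∣nno = coprime-factors {m} {n} m⊥n d∣mo d∣no
  where
  d∣no : d ∣ n * o
  d∣no = coprime-factors {m} {n} m⊥n
    (subst (d ∣_) (x∙yz≈y∙xz n m o) (∣n⇒∣m*n n d∣mo))
    (subst (d ∣_) (*-assoc n n o) d∣nno)

coprime-squares : ∀ {m n d o} → Coprime m n → d ∣ (m * m) * o → d ∣ (n * n) * o → d ∣ o
coprime-squares {m} {n} {d} {o} m⊥n d∣mmo d∣nno = coprime-factors-square {m} {n} m⊥n d∣mo d∣nno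
  where
  d∣mo : d ∣ m * o
  d∣mo = coprime-factors-square {m} {n} m⊥n
    (subst (d ∣_) (*-assoc m m o) d∣mmo)
    (subst (d ∣_) (x∙yz≈y∙xz m (n * n) o) (∣n⇒∣m*n m d∣nno))

q*u≡p*X⇒q∣X : ∀ {p q u X} → Coprime p q → q * u ≡ p * X → q ∣ X
q*u≡p*X⇒q∣X {p} {q} {u} {X} p⊥q qu≡pX =
  ∣ᵤ⇒∣ (coprime-divisor q p X (coprime-sym {p} {q} p⊥q) (∣⇒∣ᵤ (subst (q ∣_) qu≡pX (∣m⇒∣m*n u ∣-refl))))

common-factor : ∀ {a b} → ¬ (a ≡ + 0 × b ≡ + 0) →
  ∃[ g ] ∃[ m ] ∃[ n ] (g ≢ + 0 × a ≡ m * g × b ≡ n * g × Coprime m n)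
common-factor {a} {b} ab≢0 = g , quotient g∣a , quotient g∣b , g≢0 , equality g∣a , equality g∣b , m⊥n
  where
  open _∣_
  g = gcd a b
  g≢0 : g ≢ + 0
  g≢0 g≡0 = ab≢0 (gcd[i,j]≡0⇒i≡0 a b g≡0 , gcd[i,j]≡0⇒j≡0 {a} {b} g≡0)
  g∣a : g ∣ a
  g∣a = ∣ᵤ⇒∣ (gcd[i,j]∣i a b)
  g∣b : g ∣ b
  g∣b = ∣ᵤ⇒∣ (gcd[i,j]∣j a b)
  *g∣c : ∀ {i c} (g∣c : g ∣ c) → + i ∣ quotient g∣c → + i * g ∣ c
  *g∣c g∣c i∣k = subst (_ ∣_) (sym (equality g∣c)) (*-monoˡ-∣ g i∣k)
  m⊥n : Coprime (quotient g∣a) (quotient g∣b)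
  m⊥n {i} (i∣m , i∣n) = ℕ.∣1⇒≡1 (∣⇒∣ᵤ (*-cancelʳ-∣ g {+ i} {+ 1} {{≢-nonZero g≢0}} ig∣1g))
    where
    ig∣1g : + i * g ∣ + 1 * g
    ig∣1g = subst (+ i * g ∣_) (sym (*-identityˡ g))
      (∣ᵤ⇒∣ (gcd-greatest {a} {b} {+ i * g} (∣⇒∣ᵤ (*g∣c g∣a (∣ᵤ⇒∣ {+ i} i∣m))) (∣⇒∣ᵤ (*g∣c g∣b (∣ᵤ⇒∣ {+ i} i∣n)))))

lowest-terms : ∀ a {b} → b ≢ + 0 →
  ∃[ h ] ∃[ p ] ∃[ q ] (h ≢ + 0 × a ≡ p * h × b ≡ q * h × Coprime p q × + 0 < q)
lowest-terms a {b} b≢0 with common-factor {a} {b} (b≢0 ∘ proj₂)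
... | g , p , + 0 , g≢0 , a≡pg , b≡0 , p⊥q = contradiction b≡0 b≢0
... | g , p , +[1+ k ] , g≢0 , a≡pg , b≡qg , p⊥q =
  g , p , +[1+ k ] , g≢0 , a≡pg , b≡qg , p⊥q , +<+ (ℕ.s≤s ℕ.z≤n)
... | g , p , -[1+ k ] , g≢0 , a≡pg , b≡qg , p⊥q =
  - g , - p , +[1+ k ] , g≢0 ∘ neg-injective ,
  trans a≡pg (sym (-i*-j≡i*j p g)) , trans b≡qg (sym (-i*-j≡i*j -[1+ k ] g)) ,
  subst (λ t → ℕ.Coprime t (ℕ.suc k)) (sym (∣-i∣≡∣i∣ p)) p⊥q , +<+ (ℕ.s≤s ℕ.z≤n)

Q : (A B C x y z : ℤ) → ℤ
Q A B C x y z = A * (x * x) + B * (y * y) + C * (z * z)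

Q-scale : ∀ A B C k x y z →
  A * ((k * x) * (k * x)) + B * ((k * y) * (k * y)) + C * ((k * z) * (k * z))
  ≡ k * k * (A * (x * x) + B * (y * y) + C * (z * z))
Q-scale = solve-∀

Q-at-P : ∀ A B C x₀ y₀ z₀ m n →
  let X = x₀ * A * (m * m) + + 2 * y₀ * B * (m * n) + - (x₀ * B * (n * n))
      Y = - (y₀ * A * (m * m)) + + 2 * x₀ * A * (m * n) + y₀ * B * (n * n)
      Z = z₀ * A * (m * m) + z₀ * B * (n * n)
      S = A * (m * m) + B * (n * n)
  in A * (X * X) + B * (Y * Y) + C * (Z * Z) ≡ S * S * (A * (x₀ * x₀) + B * (y₀ * y₀) + C * (z₀ * z₀))
Q-at-P = solve-∀

IsSol-swap : ∀ A B C x y z → IsSol A B C x y z → IsSol B A C y x z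
IsSol-swap A B C x y z = trans (cong (_+ C * (z * z)) (+-comm (B * (y * y)) (A * (x * x))))

Px-homogeneous : ∀ A B x₀ y₀ m n g →
  x₀ * A * ((m * g) * (m * g)) + + 2 * y₀ * B * ((m * g) * (n * g)) + - (x₀ * B * ((n * g) * (n * g)))
  ≡ g * g * (x₀ * A * (m * m) + + 2 * y₀ * B * (m * n) + - (x₀ * B * (n * n)))
Px-homogeneous = solve-∀

Py-homogeneous : ∀ A B x₀ y₀ m n g →
  - (y₀ * A * ((m * g) * (m * g))) + + 2 * x₀ * A * ((m * g) * (n * g)) + y₀ * B * ((n * g) * (n * g))
  ≡ g * g * (- (y₀ * A * (m * m)) + + 2 * x₀ * A * (m * n) + y₀ * B * (n * n))
Py-homogeneous = solve-∀

Pz-homogeneous : ∀ A B z₀ m n g →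
  z₀ * A * ((m * g) * (m * g)) + z₀ * B * ((n * g) * (n * g)) ≡ g * g * (z₀ * A * (m * m) + z₀ * B * (n * n))
Pz-homogeneous = solve-∀

Px-swap : ∀ A B x₀ y₀ m n →
  y₀ * B * (n * n) + + 2 * x₀ * A * (n * m) + - (y₀ * A * (m * m))
  ≡ - (y₀ * A * (m * m)) + + 2 * x₀ * A * (m * n) + y₀ * B * (n * n)
Px-swap = solve-∀

Py-swap : ∀ A B x₀ y₀ m n →
  - (x₀ * B * (n * n)) + + 2 * y₀ * B * (n * m) + x₀ * A * (m * m)
  ≡ x₀ * A * (m * m) + + 2 * y₀ * B * (m * n) + - (x₀ * B * (n * n))
Py-swap = solve-∀

Pz-swap : ∀ A B z₀ m n → z₀ * B * (n * n) + z₀ * A * (m * m) ≡ z₀ * A * (m * m) + z₀ * B * (n * n)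
Pz-swap = solve-∀

record ScaledImage (A B x₀ y₀ z₀ m n ℓ x y z : ℤ) : Set where
  constructor ⟨_,_,_⟩
  field
    Px≡ℓx : Px A B x₀ y₀ z₀ m n ≡ ℓ * x
    Py≡ℓy : Py A B x₀ y₀ z₀ m n ≡ ℓ * y
    Pz≡ℓz : Pz A B x₀ y₀ z₀ m n ≡ ℓ * z

ScaledImage-swap : ∀ {A B x₀ y₀ z₀ m n ℓ x y z} →
  ScaledImage B A y₀ x₀ z₀ n m ℓ y x z → ScaledImage A B x₀ y₀ z₀ m n ℓ x y z
ScaledImage-swap {A} {B} {x₀} {y₀} {z₀} {m} {n} ⟨ X′≡ℓy , Y′≡ℓx , Z′≡ℓz ⟩ = ⟨
  trans (sym (Py-swap A B x₀ y₀ m n)) Y′≡ℓx ,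
  trans (sym (Px-swap A B x₀ y₀ m n)) X′≡ℓy ,
  trans (sym (Pz-swap A B z₀ m n)) Z′≡ℓz ⟩

Px-on-line : ∀ A B C x₀ y₀ z₀ x y z →
  let E  = A * (x * x) + B * (y * y) + C * (z * z)
      E₀ = A * (x₀ * x₀) + B * (y₀ * y₀) + C * (z₀ * z₀)
      M  = A * x * x₀ - B * y * y₀ - C * z * z₀
      m  = M
      n  = A * (x * y₀ + y * x₀)
  in x₀ * A * (m * m) + + 2 * y₀ * B * (m * n) + - (x₀ * B * (n * n))
     ≡ - + 2 * A * C * (z₀ * z₀) * M * x + E * - (A * x₀ * (A * (x₀ * x₀) + B * (y₀ * y₀)))
       + E₀ * (A * (x₀ * C * (z * z) + + 2 * M * x))
Px-on-line = solve-∀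

Py-on-line : ∀ A B C x₀ y₀ z₀ x y z →
  let E  = A * (x * x) + B * (y * y) + C * (z * z)
      E₀ = A * (x₀ * x₀) + B * (y₀ * y₀) + C * (z₀ * z₀)
      M  = A * x * x₀ - B * y * y₀ - C * z * z₀
      m  = M
      n  = A * (x * y₀ + y * x₀)
  in - (y₀ * A * (m * m)) + + 2 * x₀ * A * (m * n) + y₀ * B * (n * n)
     ≡ - + 2 * A * C * (z₀ * z₀) * M * y + E * (A * y₀ * (A * (x₀ * x₀) + B * (y₀ * y₀)))
       + E₀ * (A * (- (y₀ * C * (z * z)) + + 2 * M * y))
Py-on-line = solve-∀

Pz-on-line : ∀ A B C x₀ y₀ z₀ x y z →
  let E  = A * (x * x) + B * (y * y) + C * (z * z)
      E₀ = A * (x₀ * x₀) + B * (y₀ * y₀) + C * (z₀ * z₀)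
      M  = A * x * x₀ - B * y * y₀ - C * z * z₀
      m  = M
      n  = A * (x * y₀ + y * x₀)
  in z₀ * A * (m * m) + z₀ * B * (n * n)
     ≡ - + 2 * A * C * (z₀ * z₀) * M * z + E * (A * z₀ * (A * (x₀ * x₀) + B * (y₀ * y₀)))
       + E₀ * - (A * z₀ * C * (z * z))
Pz-on-line = solve-∀

line-through-base : ∀ A B C x₀ y₀ z₀ x y z → IsSol A B C x₀ y₀ z₀ → IsSol A B C x y z →
  let M = A * x * x₀ - B * y * y₀ - C * z * z₀ in
  ScaledImage A B x₀ y₀ z₀ M (A * (x * y₀ + y * x₀)) (- + 2 * A * C * (z₀ * z₀) * M) x y z
line-through-base A B C x₀ y₀ z₀ x y z base sol = ⟨
  drop-null-term sol (drop-null-term base (Px-on-line A B C x₀ y₀ z₀ x y z)) ,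
  drop-null-term sol (drop-null-term base (Py-on-line A B C x₀ y₀ z₀ x y z)) ,
  drop-null-term sol (drop-null-term base (Pz-on-line A B C x₀ y₀ z₀ x y z)) ⟩

line-scale-≢0 : ∀ {A C z₀ M} → A ≢ + 0 → C ≢ + 0 → z₀ ≢ + 0 → M ≢ + 0 →
  - + 2 * A * C * (z₀ * z₀) * M ≢ + 0
line-scale-≢0 A≢0 C≢0 z₀≢0 = *-≢0 (*-≢0 (*-≢0 (*-≢0 -2≢0 A≢0) C≢0) (*-≢0 z₀≢0 z₀≢0))

bound-identityᴬ : ∀ A B C x₀ y₀ z₀ m n →
  let X = x₀ * A * (m * m) + + 2 * y₀ * B * (m * n) + - (x₀ * B * (n * n))
      Y = - (y₀ * A * (m * m)) + + 2 * x₀ * A * (m * n) + y₀ * B * (n * n)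
      Z = z₀ * A * (m * m) + z₀ * B * (n * n)
  in C * z₀ * Z - (A * x₀ * X - B * y₀ * Y)
     ≡ m * m * (+ 2 * A * C * (z₀ * z₀))
       + (A * (x₀ * x₀) + B * (y₀ * y₀) + C * (z₀ * z₀)) * (B * (n * n) - A * (m * m))
bound-identityᴬ = solve-∀

bound-identityᴮ : ∀ A B C x₀ y₀ z₀ m n →
  let X = x₀ * A * (m * m) + + 2 * y₀ * B * (m * n) + - (x₀ * B * (n * n))
      Y = - (y₀ * A * (m * m)) + + 2 * x₀ * A * (m * n) + y₀ * B * (n * n)
      Z = z₀ * A * (m * m) + z₀ * B * (n * n)
  in A * x₀ * X - B * y₀ * Y + C * z₀ * Z
     ≡ n * n * (+ 2 * B * C * (z₀ * z₀))
       + (A * (x₀ * x₀) + B * (y₀ * y₀) + C * (z₀ * z₀)) * (A * (m * m) - B * (n * n))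
bound-identityᴮ = solve-∀

∣P⇒∣2lcm[A,B]Cz₀² : ∀ A B C x₀ y₀ z₀ m n {d} → IsSol A B C x₀ y₀ z₀ → Coprime m n →
  d ∣ Px A B x₀ y₀ z₀ m n → d ∣ Py A B x₀ y₀ z₀ m n → d ∣ Pz A B x₀ y₀ z₀ m n →
  d ∣ + 2 * lcm A B * C * (z₀ * z₀)
∣P⇒∣2lcm[A,B]Cz₀² A B C x₀ y₀ z₀ m n {d} base m⊥n d∣X d∣Y d∣Z =
  coprime-squares {m} {n} m⊥n
    (enlarge A (m * m) (i∣lcm[i,j] A B) d∣mmA)
    (enlarge B (n * n) (j∣lcm[i,j] A B) d∣nnB)
  where
  d∣AxX-ByY : d ∣ A * x₀ * Px A B x₀ y₀ z₀ m n - B * y₀ * Py A B x₀ y₀ z₀ m n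
  d∣AxX-ByY = ∣m∣n⇒∣m-n (∣n⇒∣m*n (A * x₀) d∣X) (∣n⇒∣m*n (B * y₀) d∣Y)
  d∣CzZ : d ∣ C * z₀ * Pz A B x₀ y₀ z₀ m n
  d∣CzZ = ∣n⇒∣m*n (C * z₀) d∣Z
  d∣mmA : d ∣ m * m * (+ 2 * A * C * (z₀ * z₀))
  d∣mmA = subst (d ∣_) (drop-null-term base (bound-identityᴬ A B C x₀ y₀ z₀ m n)) (∣m∣n⇒∣m-n d∣CzZ d∣AxX-ByY)
  d∣nnB : d ∣ n * n * (+ 2 * B * C * (z₀ * z₀))
  d∣nnB = subst (d ∣_) (drop-null-term base (bound-identityᴮ A B C x₀ y₀ z₀ m n)) (∣m∣n⇒∣m+n d∣AxX-ByY d∣CzZ)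
  enlarge : ∀ k j → k Unsigned.∣ lcm A B →
    d ∣ j * (+ 2 * k * C * (z₀ * z₀)) → d ∣ j * (+ 2 * lcm A B * C * (z₀ * z₀))
  enlarge k j k∣lcm d∣ = ∣-trans d∣
    (*-monoʳ-∣ j (*-monoˡ-∣ (z₀ * z₀) (*-monoˡ-∣ C (*-monoʳ-∣ (+ 2) {k} {lcm A B} (∣ᵤ⇒∣ k∣lcm)))))

represent : ∀ {A B C x₀ y₀ z₀ x y z a b ℓ} → IsSol A B C x₀ y₀ z₀ → ¬ (a ≡ + 0 × b ≡ + 0) → ℓ ≢ + 0 →
  ScaledImage A B x₀ y₀ z₀ a b ℓ x y z →
  ∃[ m ] ∃[ n ] ∃[ p ] ∃[ q ] Represents A B C x₀ y₀ z₀ x y z m n p q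
represent {A} {B} {C} {x₀} {y₀} {z₀} {x} {y} {z} {a} {b} {ℓ} base ab≢0 ℓ≢0 ⟨ X≡ℓx , Y≡ℓy , Z≡ℓz ⟩
  with common-factor {a} {b} ab≢0
... | g , m , n , _ , refl , refl , m⊥n with lowest-terms (g * g) ℓ≢0
... | h , p , q , h≢0 , gg≡ph , ℓ≡qh , p⊥q , 0<q =
  m , n , p , q , m⊥n , p⊥q , 0<q ,
  ∣⇒∣ᵤ (∣P⇒∣2lcm[A,B]Cz₀² A B C x₀ y₀ z₀ m n base m⊥n (q∣ qx≡pX) (q∣ qy≡pY) (q∣ qz≡pZ)) ,
  qx≡pX , qy≡pY , qz≡pZ
  where
  reduce : ∀ {X u} → g * g * X ≡ ℓ * u → q * u ≡ p * X
  reduce {X} {u} ggX≡ℓu = *-cancelˡ-≡ h (q * u) (p * X) {{≢-nonZero h≢0}} (begin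
    h * (q * u)  ≡⟨ x∙yz≈yx∙z h q u ⟩
    q * h * u    ≡⟨ cong (_* u) ℓ≡qh ⟨
    ℓ * u        ≡⟨ ggX≡ℓu ⟨
    g * g * X    ≡⟨ cong (_* X) gg≡ph ⟩
    p * h * X    ≡⟨ xy∙z≈y∙xz p h X ⟩
    h * (p * X)  ∎)
    where open ≡-Reasoning
  q∣ : ∀ {u X} → q * u ≡ p * X → q ∣ X
  q∣ = q*u≡p*X⇒q∣X {p} {q} p⊥q
  qx≡pX : q * x ≡ p * Px A B x₀ y₀ z₀ m n
  qx≡pX = reduce (trans (sym (Px-homogeneous A B x₀ y₀ m n g)) X≡ℓx)
  qy≡pY : q * y ≡ p * Py A B x₀ y₀ z₀ m n
  qy≡pY = reduce (trans (sym (Py-homogeneous A B x₀ y₀ m n g)) Y≡ℓy)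
  qz≡pZ : q * z ≡ p * Pz A B x₀ y₀ z₀ m n
  qz≡pZ = reduce (trans (sym (Pz-homogeneous A B z₀ m n g)) Z≡ℓz)

M+M′-identity : ∀ A B C x y z x₀ y₀ z₀ →
  - + 2 * C * z₀ * z ≡ (A * x * x₀ - B * y * y₀ - C * z * z₀) + (B * y * y₀ - A * x * x₀ - C * z * z₀)
M+M′-identity = solve-∀

M-identity : ∀ A B C x y x₀ y₀ z₀ →
  let M = A * x * x₀ - B * y * y₀ - C * + 0 * z₀ in
  B * C * (z₀ * z₀) * (y * y)
  ≡ + 0 + M * (M + + 2 * B * y * y₀) + (A * (x * x) + B * (y * y) + C * (+ 0 * + 0)) * - (A * (x₀ * x₀))
    + (A * (x₀ * x₀) + B * (y₀ * y₀) + C * (z₀ * z₀)) * (B * (y * y))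
M-identity = solve-∀

M≡0⇒y≡0 : ∀ A B C x₀ y₀ z₀ x y → B ≢ + 0 → C ≢ + 0 → z₀ ≢ + 0 →
  IsSol A B C x₀ y₀ z₀ → IsSol A B C x y (+ 0) → A * x * x₀ - B * y * y₀ - C * + 0 * z₀ ≡ + 0 → y ≡ + 0
M≡0⇒y≡0 A B C x₀ y₀ z₀ x y B≢0 C≢0 z₀≢0 base sol M≡0 =
  i*i≡0⇒i≡0 (i*j≡0⇒j≡0 (*-≢0 (*-≢0 B≢0 C≢0) (*-≢0 z₀≢0 z₀≢0))
    (drop-null-term M≡0 (drop-null-term sol (drop-null-term base (M-identity A B C x y x₀ y₀ z₀)))))

null-solution : ∀ A B C x₀ y₀ z₀ x y z → A ≢ + 0 → B ≢ + 0 → C ≢ + 0 → z₀ ≢ + 0 →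
  IsSol A B C x₀ y₀ z₀ → IsSol A B C x y z →
  A * x * x₀ - B * y * y₀ - C * z * z₀ ≡ + 0 → B * y * y₀ - A * x * x₀ - C * z * z₀ ≡ + 0 →
  x ≡ + 0 × y ≡ + 0 × z ≡ + 0
null-solution A B C x₀ y₀ z₀ x y z A≢0 B≢0 C≢0 z₀≢0 base sol M≡0 M′≡0
  with i*j≡0⇒j≡0 (*-≢0 (*-≢0 -2≢0 C≢0) z₀≢0) (trans (M+M′-identity A B C x y z x₀ y₀ z₀) (cong₂ _+_ M≡0 M′≡0))
... | refl =
  M≡0⇒y≡0 B A C y₀ x₀ z₀ y x A≢0 C≢0 z₀≢0
    (IsSol-swap A B C x₀ y₀ z₀ base) (IsSol-swap A B C x y (+ 0) sol) M′≡0 ,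
  M≡0⇒y≡0 A B C x₀ y₀ z₀ x y B≢0 C≢0 z₀≢0 base sol M≡0 ,
  refl

zero-represented : ∀ A B C x₀ y₀ z₀ → Represents A B C x₀ y₀ z₀ (+ 0) (+ 0) (+ 0) (+ 1) (+ 0) (+ 0) (+ 1)
zero-represented A B C x₀ y₀ z₀ =
  ℕ.1-coprimeTo 0 , ℕ.sym (ℕ.1-coprimeTo 0) , +<+ (ℕ.s≤s ℕ.z≤n) , ℕ.1∣ _ , refl , refl , refl

solution⇒represented : ∀ A B C x₀ y₀ z₀ → A ≢ + 0 → B ≢ + 0 → C ≢ + 0 → z₀ ≢ + 0 →
  IsSol A B C x₀ y₀ z₀ → (x y z : ℤ) → IsSol A B C x y z →
  ∃[ m ] ∃[ n ] ∃[ p ] ∃[ q ] Represents A B C x₀ y₀ z₀ x y z m n p q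
solution⇒represented A B C x₀ y₀ z₀ A≢0 B≢0 C≢0 z₀≢0 base x y z sol
  with A * x * x₀ - B * y * y₀ - C * z * z₀ ≟ + 0 | B * y * y₀ - A * x * x₀ - C * z * z₀ ≟ + 0
... | no M≢0 | _ =
  represent base (M≢0 ∘ proj₁) (line-scale-≢0 A≢0 C≢0 z₀≢0 M≢0) (line-through-base A B C x₀ y₀ z₀ x y z base sol)
... | yes _ | no M′≢0 =
  represent base (M′≢0 ∘ proj₂) (line-scale-≢0 B≢0 C≢0 z₀≢0 M′≢0)
    (ScaledImage-swap (line-through-base B A C y₀ x₀ z₀ y x z
      (IsSol-swap A B C x₀ y₀ z₀ base) (IsSol-swap A B C x y z sol)))
... | yes M≡0 | yes M′≡0 with null-solution A B C x₀ y₀ z₀ x y z A≢0 B≢0 C≢0 z₀≢0 base sol M≡0 M′≡0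
...   | refl , refl , refl = + 1 , + 0 , + 0 , + 1 , zero-represented A B C x₀ y₀ z₀

represented⇒solution : ∀ A B C x₀ y₀ z₀ → IsSol A B C x₀ y₀ z₀ →
  (x y z m n p q : ℤ) → Represents A B C x₀ y₀ z₀ x y z m n p q → IsSol A B C x y z
represented⇒solution A B C x₀ y₀ z₀ base x y z m n p q
  (_ , _ , 0<q , _ , qx≡pX , qy≡pY , qz≡pZ) =
  i*j≡0⇒j≡0 (*-≢0 q≢0 q≢0) (begin
    q * q * Q A B C x y z                ≡⟨ Q-scale A B C q x y z ⟨
    Q A B C (q * x) (q * y) (q * z)      ≡⟨ cong₂ (λ u v → Q A B C u v (q * z)) qx≡pX qy≡pY ⟩
    Q A B C (p * X) (p * Y) (q * z)      ≡⟨ cong (Q A B C (p * X) (p * Y)) qz≡pZ ⟩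
    Q A B C (p * X) (p * Y) (p * Z)      ≡⟨ Q-scale A B C p X Y Z ⟩
    p * p * Q A B C X Y Z                ≡⟨ cong (p * p *_) (Q-at-P A B C x₀ y₀ z₀ m n) ⟩
    p * p * (S * S * Q A B C x₀ y₀ z₀)   ≡⟨ cong (λ e → p * p * (S * S * e)) base ⟩
    p * p * (S * S * + 0)                ≡⟨ cong (p * p *_) (*-zeroʳ (S * S)) ⟩
    p * p * + 0                          ≡⟨ *-zeroʳ (p * p) ⟩
    + 0                                  ∎)
  where
  open ≡-Reasoning
  X = Px A B x₀ y₀ z₀ m n
  Y = Py A B x₀ y₀ z₀ m n
  Z = Pz A B x₀ y₀ z₀ m n
  S = A * (m * m) + B * (n * n)
  q≢0 : q ≢ + 0
  q≢0 = <⇒≢ 0<q ∘ sym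

theorem5 : (A B C x₀ y₀ z₀ : ℤ) →
    ¬ A ≡ + 0 → ¬ B ≡ + 0 → ¬ C ≡ + 0 →
    IsSol A B C x₀ y₀ z₀ →
    ¬ (x₀ ≡ + 0 × y₀ ≡ + 0 × z₀ ≡ + 0) →
    ¬ z₀ ≡ + 0 →
    ((x y z : ℤ) → IsSol A B C x y z →
       ∃[ m ] ∃[ n ] ∃[ p ] ∃[ q ] Represents A B C x₀ y₀ z₀ x y z m n p q)
    × ((x y z m n p q : ℤ) → Represents A B C x₀ y₀ z₀ x y z m n p q →
       IsSol A B C x y z)
theorem5 A B C x₀ y₀ z₀ A≢0 B≢0 C≢0 base _ z₀≢0 =
  solution⇒represented A B C x₀ y₀ z₀ A≢0 B≢0 C≢0 z₀≢0 base , represented⇒solution A B C x₀ y₀ z₀ base
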